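{- Let $G$ and $H$ be da-hypomorphic graphs or digraphs. If there exists a dapasting $P$ of two dacards of $G$ as members of $\mathrm{Dadeck}(G)$ such that $P$ is (isomorphic to) a subgraph/subdigraph of $H$ but $P$ is not a dapasting in $H$, then $G$ is not da-reconstructible.
   Context: Digraphs are finite, without loops or multiple arcs; a graph is regarded as a digraph whose edges are pairs of opposite arcs. For a vertex $x$ of $D$, $\mathrm{dt}_D(x)=(a,b,c)$ counts vertices $w$ with only $xw$, only $wx$, both $xw,wx$ arcs. Dacards are pairs $(D-x,\mathrm{dt}_D(x))$ with $D-x$ up to isomorphism; the dadeck is the multiset of dacards; digraphs with equal dadecks are da-hypomorphs; $G$ is da-reconstructible if it is isomorphic to all its da-hypomorphs. A dapasting of dacards $(A,\alpha),(B,\beta)$ of $G$ (from distinct vertices) as members of $\mathrm{Dadeck}(G)$ is a digraph $P$ with distinct non-adjacent vertices $u,v$ labeled $(e,\alpha),(e,\beta)$, with $P-u\cong A$, $P-v\cong B$, such that some $Y\in\{P,P+uv,P+vu,P+uv+vu\}$ has $\mathrm{dt}_Y(u)=\alpha$, $\mathrm{dt}_Y(v)=\beta$ and is da-hypomorphic to $G$; digraphs isomorphic to such $Y$ are completions of $P$. $P$ is a dapasting in a digraph $J$ if $J$ is a completion of $P$. -}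

module Defs where

open import Data.Nat using (ℕ; zero; suc; _+_)
open import Data.Bool using (Bool; true; false; _∧_; _∨_; not; if_then_else_)
open import Data.Fin using (Fin; zero; suc; punchIn; _≟_)
open import Data.Fin.Permutation using (Permutation′; _⟨$⟩ʳ_)
open import Data.Product using (Σ; _×_; _,_; ∃)
open import Function.Definitions using (Injective)
open import Relation.Nullary using (¬_; yes; no)
open import Relation.Nullary.Decidable using (⌊_⌋)
open import Relation.Binary.PropositionalEquality using (_≡_; _≢_; refl)
open import Data.Empty using (⊥-elim)

-- Digraphs on vertex set Fin n: arc relation as a Bool matrix, no loops.
-- A graph is a digraph with symmetric arc relation.

record Digraph (n : ℕ) : Set where
  field
    adj      : Fin n → Fin n → Bool
    loopless : ∀ i → adj i i ≡ false
open Digraph public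

_≅_ : ∀ {n} → Digraph n → Digraph n → Set
_≅_ {n} D E = Σ (Permutation′ n) λ π →
  ∀ i j → adj D i j ≡ adj E (π ⟨$⟩ʳ i) (π ⟨$⟩ʳ j)

IsoSubdigraph : ∀ {m k} → Digraph m → Digraph k → Set
IsoSubdigraph {m} {k} D E = Σ (Fin m → Fin k) λ f →
  Injective _≡_ _≡_ f × (∀ i j → adj D i j ≡ true → adj E (f i) (f j) ≡ true)

_─_ : ∀ {n} → Digraph (suc n) → Fin (suc n) → Digraph n
D ─ x = record
  { adj      = λ i j → adj D (punchIn x i) (punchIn x j)
  ; loopless = λ i → loopless D (punchIn x i) }

count : ∀ {n} → (Fin n → Bool) → ℕ
count {zero}  p = 0
count {suc n} p = (if p zero then 1 else 0) + count (λ i → p (suc i))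

-- Degree triple dt_D(x) = (a , b , c):
-- a = #{w | only xw}, b = #{w | only wx}, c = #{w | both xw and wx}.
-- (Since D has no loops, w = x never contributes.)
DegTriple : Set
DegTriple = ℕ × ℕ × ℕ

dt : ∀ {n} → Digraph n → Fin n → DegTriple
dt D x =
  ( count (λ w → adj D x w ∧ not (adj D w x))
  , count (λ w → not (adj D x w) ∧ adj D w x)
  , count (λ w → adj D x w ∧ adj D w x) )

-- Da-hypomorphism: the dadecks (multisets of dacards (D - x , dt_D(x)),
-- cards up to isomorphism) coincide, i.e. there is a bijection σ of
-- the vertices matching every dacard of D with an equal dacard of E.
DaHypomorphic : ∀ {n} → Digraph (suc n) → Digraph (suc n) → Set
DaHypomorphic {n} D E = Σ (Permutation′ (suc n)) λ σ →
  ∀ x → ((D ─ x) ≅ (E ─ (σ ⟨$⟩ʳ x))) × (dt D x ≡ dt E (σ ⟨$⟩ʳ x))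

DaReconstructible : ∀ {n} → Digraph (suc n) → Set
DaReconstructible {n} G = ∀ (H : Digraph (suc n)) → DaHypomorphic H G → H ≅ G

addArc : ∀ {n} (D : Digraph n) (u v : Fin n) → u ≢ v → Digraph n
addArc D u v u≢v = record
  { adj      = λ i j → adj D i j ∨ (⌊ i ≟ u ⌋ ∧ ⌊ j ≟ v ⌋)
  ; loopless = lp }
  where
  lp : ∀ i → (adj D i i ∨ (⌊ i ≟ u ⌋ ∧ ⌊ i ≟ v ⌋)) ≡ false
  lp i rewrite loopless D i with i ≟ u
  ... | no _ = refl
  lp i | yes refl with i ≟ v
  ... | no _ = refl
  ... | yes e = ⊥-elim (u≢v e)

addArcs : ∀ {n} (P : Digraph n) (u v : Fin n) → u ≢ v → Bool → Bool → Digraph n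
addArcs P u v u≢v b₁ b₂ =
  let P₁ = if b₁ then addArc P u v u≢v else P in
  if b₂ then addArc P₁ v u (λ e → u≢v (sym′ e)) else P₁
  where
  sym′ : ∀ {A : Set} {a b : A} → a ≡ b → b ≡ a
  sym′ refl = refl

Completion : ∀ {n} (G : Digraph (suc n)) (α β : DegTriple)
  (P : Digraph (suc n)) (u v : Fin (suc n)) → u ≢ v →
  Digraph (suc n) → Set
Completion G α β P u v u≢v J = Σ Bool λ b₁ → Σ Bool λ b₂ →
  let Y = addArcs P u v u≢v b₁ b₂ in
  (dt Y u ≡ α) × (dt Y v ≡ β) × DaHypomorphic Y G × (J ≅ Y)

DaPasting : ∀ {n} (G : Digraph (suc n)) (x y : Fin (suc n))
  (P : Digraph (suc n)) (u v : Fin (suc n)) → u ≢ v → Set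
DaPasting G x y P u v u≢v =
  (x ≢ y) ×
  (adj P u v ≡ false) × (adj P v u ≡ false) ×
  ((P ─ u) ≅ (G ─ x)) × ((P ─ v) ≅ (G ─ y)) ×
  ∃ (Completion G (dt G x) (dt G y) P u v u≢v)

DaPastingIn : ∀ {n} (G : Digraph (suc n)) (x y : Fin (suc n))
  (P : Digraph (suc n)) (u v : Fin (suc n)) → u ≢ v →
  Digraph (suc n) → Set
DaPastingIn G x y P u v u≢v J = Completion G (dt G x) (dt G y) P u v u≢v J

{-# OPTIONS --safe #-}
module Submission where

open import Defs
open import Data.Nat using (ℕ; suc)
open import Data.Fin using (Fin)
open import Data.Fin.Permutation using (_⟨$⟩ˡ_; flip; _∘ₚ_; inverseʳ)
open import Data.Product using (_,_)
open import Relation.Nullary using (¬_)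
open import Relation.Binary.PropositionalEquality
  using (_≡_; _≢_; sym; trans; cong₂; subst)

-- If G were da-reconstructible, every da-hypomorph of G would be isomorphic
-- to G; in particular H and the completion Y of P would be isomorphic, so H
-- itself would be a completion of P, i.e. P would be a dapasting in H.

≅-sym : ∀ {n} {D E : Digraph n} → D ≅ E → E ≅ D
≅-sym {E = E} (π , π-iso) = flip π , λ i j →
  sym (trans (π-iso (π ⟨$⟩ˡ i) (π ⟨$⟩ˡ j))
             (cong₂ (adj E) (inverseʳ π) (inverseʳ π)))

≅-trans : ∀ {n} {D E F : Digraph n} → D ≅ E → E ≅ F → D ≅ F
≅-trans (π , π-iso) (ρ , ρ-iso) = π ∘ₚ ρ , λ i j → trans (π-iso i j) (ρ-iso _ _)

DaHypomorphic-sym : ∀ {n} {D E : Digraph (suc n)} →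
  DaHypomorphic D E → DaHypomorphic E D
DaHypomorphic-sym {D = D} {E} (σ , match) = flip σ , λ x →
  let card≅ , dt≡ = match (σ ⟨$⟩ˡ x) in
  ≅-sym {D = D ─ (σ ⟨$⟩ˡ x)} {E ─ x}
    (subst (λ z → (D ─ (σ ⟨$⟩ˡ x)) ≅ (E ─ z)) (inverseʳ σ) card≅) ,
  sym (subst (λ z → dt D (σ ⟨$⟩ˡ x) ≡ dt E z) (inverseʳ σ) dt≡)

DaReconstructible⇒hypomorphs-≅ : ∀ {n} {G D E : Digraph (suc n)} →
  DaReconstructible G → DaHypomorphic D G → DaHypomorphic E G → D ≅ E
DaReconstructible⇒hypomorphs-≅ {G = G} {D} {E} rec D~G E~G =
  ≅-trans {D = D} {G} {E} (rec D D~G) (≅-sym {D = E} {G} (rec E E~G))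

DaReconstructible⇒DaPastingIn : ∀ {n} {G H : Digraph (suc n)} →
  DaReconstructible G → DaHypomorphic G H →
  ∀ {x y P u v} {u≢v : u ≢ v} →
  DaPasting G x y P u v u≢v → DaPastingIn G x y P u v u≢v H
DaReconstructible⇒DaPastingIn {G = G} {H} rec G~H
  (_ , _ , _ , _ , _ , _ , b₁ , b₂ , dt-u , dt-v , Y~G , _) =
  b₁ , b₂ , dt-u , dt-v , Y~G ,
  DaReconstructible⇒hypomorphs-≅ {G = G} {H} {addArcs _ _ _ _ b₁ b₂}
    rec (DaHypomorphic-sym {D = G} {H} G~H) Y~G

lemma4p12 : ∀ (n : ℕ) (G H : Digraph (suc n)) → DaHypomorphic G H →
    ∀ (x y : Fin (suc n)) (P : Digraph (suc n)) (u v : Fin (suc n)) (u≢v : u ≢ v) →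
    DaPasting G x y P u v u≢v →
    IsoSubdigraph P H →
    ¬ DaPastingIn G x y P u v u≢v H →
    ¬ DaReconstructible G
lemma4p12 n G H G~H x y P u v u≢v pasting _ not-in-H rec =
  not-in-H (DaReconstructible⇒DaPastingIn {G = G} {H} rec G~H pasting)
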